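{- Let $T$ be an alternative tableau of length $n$ with the standard labeling. A cell $(i,j)$ of $T$ is free if and only if there exist $i',j'$ such that the arcs $(i',j)$ and $(i,j')$ form an out-crossing of $Arc(T)$. In that case $i'$ and $j'$ are unique.
   Context: A shape of length $n$ is a Ferrers diagram in English notation, possibly with empty rows or columns. It is determined by its south-east border, a path of $n$ unit south/west steps from the top-right corner to the bottom-left corner. South steps correspond to rows and west steps to columns. In the standard labeling, the labels $1,\dots,n$ are attached to rows and columns in the order their steps occur along this border from top-right to bottom-left. So row labels increase downwards, column labels increase leftwards, and cell $(i,j)$ (row $i$, column $j$) exists iff $i<j$. An alternative tableau is a shape with a partial filling of cells by left and up arrows such that every cell to the left of a left arrow in its row and every cell above an up arrow in its column is empty. A free row (column) is one with no left (up) arrow. A free cell is an empty cell such that there is no left arrow to its right in its row and no up arrow below it in its column. $Arc(T)$ is the arc diagram on the points $0,1,\dots,n+1$, placed left to right, with the following arcs: - an arc $(i,j)$ for each cell $(i,j)$ of $T$ containing an arrow; - an arc $(0,j)$ for each free column $j$; - an arc $(i,n+1)$ for each free row $i$; - the arc $(0,n+1)$. An arc $(a,b)$, $a<b$: - is topmost at its left endpoint $a$ if there is no arc $(a,\ell)$ with $\ell>b$; - is topmost at its right endpoint $b$ if there is no arc $(k,b)$ with $k<a$. A crossing is a pair of arcs $(i',j),(i,j')$ with $i'<i<j<j'$. It is an out-crossing if $(i',j)$ is topmost at $j$ and $(i,j')$ is topmost at $i$. -}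

module Defs where

open import Data.Nat using (ℕ; zero; suc; _<_)
open import Data.Fin using (Fin; toℕ)
open import Data.Vec using (Vec; lookup)
open import Data.Product using (Σ; ∃; ∃₂; _×_; _,_)
open import Data.Sum using (_⊎_)
open import Relation.Binary.PropositionalEquality using (_≡_; _≢_)
open import Relation.Nullary using (¬_)

-- Steps of the south-east border, read from top-right to bottom-left.
-- S (south) steps are rows, W (west) steps are columns.
data Step : Set where
  S W : Step

-- A shape of length n: its border path of n steps.  The k-th step
-- (k = 1..n, stored at position k-1) carries the label k (standard labeling).
Shape : ℕ → Set
Shape n = Vec Step n

data IsRow {n : ℕ} (s : Shape n) : ℕ → Set where
  row : (x : Fin n) → lookup s x ≡ S → IsRow s (suc (toℕ x))

data IsCol {n : ℕ} (s : Shape n) : ℕ → Set where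
  col : (x : Fin n) → lookup s x ≡ W → IsCol s (suc (toℕ x))

IsCell : {n : ℕ} → Shape n → ℕ → ℕ → Set
IsCell s i j = IsRow s i × IsCol s j × i < j

data Content : Set where
  empty left up : Content

-- Column labels increase leftwards, row labels increase downwards, so
-- "to the left of (i,j) in row i" means columns j'' > j, and
-- "above (i,j) in column j" means rows i'' < i.
record AltTableau (n : ℕ) : Set where
  field
    shape   : Shape n
    fill    : ℕ → ℕ → Content
    support : ∀ i j → fill i j ≢ empty → IsCell shape i j
    leftOK  : ∀ i j j'' → fill i j ≡ left → j < j'' → IsCell shape i j'' →
              fill i j'' ≡ empty
    upOK    : ∀ i j i'' → fill i j ≡ up → i'' < i → IsCell shape i'' j →
              fill i'' j ≡ empty

open AltTableau public

module _ {n : ℕ} (T : AltTableau n) where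

  FreeRow : ℕ → Set
  FreeRow i = IsRow (shape T) i × (∀ j → fill T i j ≢ left)

  FreeCol : ℕ → Set
  FreeCol j = IsCol (shape T) j × (∀ i → fill T i j ≢ up)

  FreeCell : ℕ → ℕ → Set
  FreeCell i j = IsCell (shape T) i j × fill T i j ≡ empty
               × (∀ j'' → j'' < j → fill T i j'' ≢ left)
               × (∀ i'' → i < i'' → fill T i'' j ≢ up)

  HasArrow : ℕ → ℕ → Set
  HasArrow i j = fill T i j ≡ left ⊎ fill T i j ≡ up

  data Arc : ℕ → ℕ → Set where
    cellArc : ∀ i j → IsCell (shape T) i j → HasArrow i j → Arc i j
    colArc  : ∀ j → FreeCol j → Arc 0 j
    rowArc  : ∀ i → FreeRow i → Arc i (suc n)
    topArc  : Arc 0 (suc n)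

  TopmostLeft : ℕ → ℕ → Set
  TopmostLeft a b = ¬ (∃ λ ℓ → b < ℓ × Arc a ℓ)

  TopmostRight : ℕ → ℕ → Set
  TopmostRight a b = ¬ (∃ λ k → k < a × Arc k b)

  Crossing : ℕ → ℕ → ℕ → ℕ → Set
  Crossing i' j i j' = Arc i' j × Arc i j' × i' < i × i < j × j < j'

  OutCrossing : ℕ → ℕ → ℕ → ℕ → Set
  OutCrossing i' j i j' =
    Crossing i' j i j' × TopmostRight i' j × TopmostLeft i j'

module Submission where

-- Being free splits into two independent conditions:
-- column j has no up arrow in a row ≥ i, and row i has no left arrow in a
-- column ≤ j.  Each condition is equivalent to the existence of one arc:
--   * column j has no up arrow in rows ≥ i  iff  some arc (i',j) has i' < i;
--     the arc can be chosen topmost at j: it is the arrow of column j in its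
--     topmost row, or the arc (0,j) when column j is free;
--   * row i has no left arrow in columns ≤ j  iff  some arc (i,j') has j < j';
--     the arc can be chosen topmost at i: it is the leftmost arrow of row i,
--     or the arc (i,n+1) when row i is free.
-- The two arcs so obtained form an out-crossing, and conversely the two arcs
-- of an out-crossing block the arrows forbidden in a free cell.  Uniqueness
-- holds because two arcs topmost at the same endpoint coincide.

open import Defs
open import Data.Nat using (ℕ; zero; suc; _<_; _≤_; z≤n; s≤s)
open import Data.Nat.Properties
  using (<-cmp; _<?_; ≤-refl; ≮⇒≥; ≰⇒>; <⇒≱; <⇒≤; <-irrefl; <-asym; <-≤-trans; ≤-<-trans;
         n<1+n; m<n⇒m<1+n; ≤∧≢⇒<; m≤n⇒m<n∨m≡n; anyUpTo?)
open import Data.Fin.Properties using (toℕ<n)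
open import Data.Product using (_×_; ∃; ∃₂; _,_; proj₁; proj₂)
open import Data.Sum using (_⊎_; inj₁; inj₂)
open import Data.Empty using (⊥-elim)
open import Function.Bundles using (_⇔_; mk⇔)
open import Relation.Nullary using (¬_; Dec; yes; no)
open import Relation.Unary using (Decidable)
open import Relation.Binary using (tri<; tri≈; tri>)
open import Relation.Binary.PropositionalEquality using (_≡_; _≢_; refl)

module _ {P : ℕ → Set} (P? : Decidable P) where

  leastWitness : ∀ v → ∃ (λ k → k < v × P k) →
                 ∃ λ k → k < v × P k × (∀ k' → k' < k → ¬ P k')
  leastWitness zero (_ , () , _)
  leastWitness (suc v) (k , s≤s k≤v , Pk) with anyUpTo? P? v
  ... | no noneBelow =
    k , s≤s k≤v , Pk , λ k' k'<k Pk' → noneBelow (k' , <-≤-trans k'<k k≤v , Pk')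
  ... | yes someBelow with leastWitness v someBelow
  ...   | k₀ , k₀<v , Pk₀ , least = k₀ , m<n⇒m<1+n k₀<v , Pk₀ , least

  greatestWitness : ∀ v → ∃ (λ ℓ → ℓ < v × P ℓ) →
                    ∃ λ ℓ → ℓ < v × P ℓ × (∀ ℓ' → ℓ < ℓ' → ℓ' < v → ¬ P ℓ')
  greatestWitness zero (_ , () , _)
  greatestWitness (suc v) (ℓ , s≤s ℓ≤v , Pℓ) with P? v
  ... | yes Pv = v , n<1+n v , Pv , λ { ℓ' v<ℓ' (s≤s ℓ'≤v) _ → <⇒≱ v<ℓ' ℓ'≤v }
  ... | no ¬Pv with greatestWitness v (ℓ , ≤∧≢⇒< ℓ≤v (λ { refl → ¬Pv Pℓ }) , Pℓ)
  ...   | ℓ₀ , ℓ₀<v , Pℓ₀ , greatest = ℓ₀ , m<n⇒m<1+n ℓ₀<v , Pℓ₀ , beyond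
    where
    beyond : ∀ ℓ' → ℓ₀ < ℓ' → ℓ' < suc v → ¬ P ℓ'
    beyond ℓ' ℓ₀<ℓ' (s≤s ℓ'≤v) with m≤n⇒m<n∨m≡n ℓ'≤v
    ... | inj₁ ℓ'<v = greatest ℓ' ℓ₀<ℓ' ℓ'<v
    ... | inj₂ refl = ¬Pv

isUp? : (c : Content) → Dec (c ≡ up)
isUp? empty = no λ ()
isUp? left  = no λ ()
isUp? up    = yes refl

isLeft? : (c : Content) → Dec (c ≡ left)
isLeft? empty = no λ ()
isLeft? left  = yes refl
isLeft? up    = no λ ()

isArrow? : (c : Content) → Dec (c ≡ left ⊎ c ≡ up)
isArrow? empty = no λ { (inj₁ ()) ; (inj₂ ()) }
isArrow? left  = yes (inj₁ refl)
isArrow? up    = yes (inj₂ refl)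

arrow≢empty : ∀ {c} → c ≡ left ⊎ c ≡ up → c ≢ empty
arrow≢empty (inj₁ refl) ()
arrow≢empty (inj₂ refl) ()

noArrow⇒empty : ∀ {c} → c ≢ left → c ≢ up → c ≡ empty
noArrow⇒empty {empty} _ _ = refl
noArrow⇒empty {left} notLeft _ = ⊥-elim (notLeft refl)
noArrow⇒empty {up} _ notUp = ⊥-elim (notUp refl)

rowPos : ∀ {n} {s : Shape n} {i} → IsRow s i → 0 < i
rowPos (row _ _) = s≤s z≤n

colBound : ∀ {n} {s : Shape n} {j} → IsCol s j → j < suc n
colBound (col x _) = s≤s (toℕ<n x)

module _ {n : ℕ} (T : AltTableau n) where

  arrowCell : ∀ {i j} → HasArrow T i j → IsCell (shape T) i j
  arrowCell arrow = support T _ _ (arrow≢empty arrow)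

  arrowColBound : ∀ {i j} → HasArrow T i j → j < suc n
  arrowColBound arrow = colBound (proj₁ (proj₂ (arrowCell arrow)))

  arrowArc : ∀ {i j} → HasArrow T i j → Arc T i j
  arrowArc arrow = cellArc _ _ (arrowCell arrow) arrow

  arcInto : ∀ {k j} → j < suc n → Arc T k j → HasArrow T k j ⊎ FreeCol T j
  arcInto _ (cellArc _ _ _ arrow) = inj₁ arrow
  arcInto _ (colArc _ free) = inj₂ free
  arcInto j<1+n (rowArc _ _) = ⊥-elim (<-irrefl refl j<1+n)
  arcInto j<1+n topArc = ⊥-elim (<-irrefl refl j<1+n)

  arcOutOf : ∀ {i ℓ} → 0 < i → Arc T i ℓ → HasArrow T i ℓ ⊎ (ℓ ≡ suc n × FreeRow T i)
  arcOutOf _ (cellArc _ _ _ arrow) = inj₁ arrow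
  arcOutOf () (colArc _ _)
  arcOutOf _ (rowArc _ free) = inj₂ (refl , free)
  arcOutOf () topArc

  arcInto-blocksUp : ∀ {i' j} → j < suc n → Arc T i' j →
                     ∀ u → i' < u → fill T u j ≢ up
  arcInto-blocksUp {i'} {j} j<1+n arc u i'<u upAt with arcInto j<1+n arc
  ... | inj₁ arrow = arrow≢empty arrow (upOK T u j i' upAt i'<u (arrowCell arrow))
  ... | inj₂ (_ , noUps) = noUps u upAt

  arcOutOf-blocksLeft : ∀ {i j'} → 0 < i → Arc T i j' →
                        ∀ ℓ → ℓ < j' → fill T i ℓ ≢ left
  arcOutOf-blocksLeft {i} {j'} 0<i arc ℓ ℓ<j' leftAt with arcOutOf 0<i arc
  ... | inj₁ arrow = arrow≢empty arrow (leftOK T i ℓ j' leftAt ℓ<j' (arrowCell arrow))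
  ... | inj₂ (_ , _ , noLefts) = noLefts ℓ leftAt

  -- If column j has no up arrow in rows ≥ i, some arc (i',j) with i' < i is
  -- topmost at j: the arrow of column j in the topmost row, else (0,j).
  topmostArcInto : ∀ {i j} → 0 < i → IsCol (shape T) j →
                   (∀ u → i ≤ u → fill T u j ≢ up) →
                   ∃ λ i' → i' < i × Arc T i' j × TopmostRight T i' j
  topmostArcInto {i} {j} 0<i colj noUpFrom
    with anyUpTo? (λ u → isUp? (fill T u j)) i
  ... | no noUpAbove = 0 , 0<i , colArc j (colj , noUpAt) , λ { (_ , () , _) }
    where
    noUpAt : ∀ u → fill T u j ≢ up
    noUpAt u upAt with u <? i
    ... | yes u<i = noUpAbove (u , u<i , upAt)
    ... | no u≮i = noUpFrom u (≮⇒≥ u≮i) upAt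
  ... | yes (u , u<i , upAt)
    with leastWitness (λ k → isArrow? (fill T k j)) i (u , u<i , inj₂ upAt)
  ...   | k , k<i , arrow , least = k , k<i , arrowArc arrow , topmost
    where
    topmost : TopmostRight T k j
    topmost (k' , k'<k , arc) with arcInto (colBound colj) arc
    ... | inj₁ arrow' = least k' k'<k arrow'
    ... | inj₂ (_ , noUps) = noUps u upAt

  -- If row i has no left arrow in columns ≤ j, some arc (i,j') with j < j' is
  -- topmost at i: the leftmost arrow of row i, else (i,n+1).
  topmostArcOutOf : ∀ {i j} → IsRow (shape T) i → j < suc n →
                    (∀ ℓ → ℓ ≤ j → fill T i ℓ ≢ left) →
                    ∃ λ j' → j < j' × Arc T i j' × TopmostLeft T i j'
  topmostArcOutOf {i} {j} rowi j<1+n noLeftUpTo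
    with anyUpTo? (λ ℓ → isLeft? (fill T i ℓ)) (suc n)
  ... | no noLeftInRow = suc n , j<1+n , rowArc i (rowi , noLeftAt) , topmost
    where
    noLeftAt : ∀ ℓ → fill T i ℓ ≢ left
    noLeftAt ℓ leftAt = noLeftInRow (ℓ , arrowColBound (inj₁ leftAt) , leftAt)
    topmost : TopmostLeft T i (suc n)
    topmost (ℓ' , 1+n<ℓ' , arc) with arcOutOf (rowPos rowi) arc
    ... | inj₁ arrow = <-asym 1+n<ℓ' (arrowColBound arrow)
    ... | inj₂ (refl , _) = <-irrefl refl 1+n<ℓ'
  ... | yes (ℓ₀ , ℓ₀<1+n , leftAt)
    with greatestWitness (λ ℓ → isArrow? (fill T i ℓ)) (suc n) (ℓ₀ , ℓ₀<1+n , inj₁ leftAt)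
  ...   | ℓ , _ , arrow , greatest = ℓ , <-≤-trans j<ℓ₀ ℓ₀≤ℓ , arrowArc arrow , topmost
    where
    j<ℓ₀ : j < ℓ₀
    j<ℓ₀ = ≰⇒> λ ℓ₀≤j → noLeftUpTo ℓ₀ ℓ₀≤j leftAt
    ℓ₀≤ℓ : ℓ₀ ≤ ℓ
    ℓ₀≤ℓ = ≮⇒≥ λ ℓ<ℓ₀ → greatest ℓ₀ ℓ<ℓ₀ ℓ₀<1+n (inj₁ leftAt)
    topmost : TopmostLeft T i ℓ
    topmost (ℓ' , ℓ<ℓ' , arc) with arcOutOf (rowPos rowi) arc
    ... | inj₁ arrow' = greatest ℓ' ℓ<ℓ' (arrowColBound arrow') arrow'
    ... | inj₂ (_ , _ , noLefts) = noLefts ℓ₀ leftAt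

  freeCell-noUpFrom : ∀ {i j} → FreeCell T i j → ∀ u → i ≤ u → fill T u j ≢ up
  freeCell-noUpFrom (_ , emptyAt , _ , noUpBelow) u i≤u upAt with m≤n⇒m<n∨m≡n i≤u
  ... | inj₁ i<u = noUpBelow u i<u upAt
  ... | inj₂ refl = arrow≢empty (inj₂ upAt) emptyAt

  freeCell-noLeftUpTo : ∀ {i j} → FreeCell T i j → ∀ ℓ → ℓ ≤ j → fill T i ℓ ≢ left
  freeCell-noLeftUpTo (_ , emptyAt , noLeftRight , _) ℓ ℓ≤j leftAt with m≤n⇒m<n∨m≡n ℓ≤j
  ... | inj₁ ℓ<j = noLeftRight ℓ ℓ<j leftAt
  ... | inj₂ refl = arrow≢empty (inj₁ leftAt) emptyAt

  freeCell-intro : ∀ {i j} → IsCell (shape T) i j →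
                   (∀ u → i ≤ u → fill T u j ≢ up) →
                   (∀ ℓ → ℓ ≤ j → fill T i ℓ ≢ left) → FreeCell T i j
  freeCell-intro {i} {j} cell noUpFrom noLeftUpTo =
      cell
    , noArrow⇒empty (noLeftUpTo j ≤-refl) (noUpFrom i ≤-refl)
    , (λ ℓ ℓ<j → noLeftUpTo ℓ (<⇒≤ ℓ<j))
    , (λ u i<u → noUpFrom u (<⇒≤ i<u))

  topmostRight-unique : ∀ {a a' b} → Arc T a b → Arc T a' b →
                        TopmostRight T a b → TopmostRight T a' b → a ≡ a'
  topmostRight-unique {a} {a'} arc arc' top top' with <-cmp a a'
  ... | tri< a<a' _ _ = ⊥-elim (top' (a , a<a' , arc))
  ... | tri≈ _ a≡a' _ = a≡a'
  ... | tri> _ _ a'<a = ⊥-elim (top (a' , a'<a , arc'))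

  topmostLeft-unique : ∀ {a b b'} → Arc T a b → Arc T a b' →
                       TopmostLeft T a b → TopmostLeft T a b' → b ≡ b'
  topmostLeft-unique {_} {b} {b'} arc arc' top top' with <-cmp b b'
  ... | tri< b<b' _ _ = ⊥-elim (top (b' , b<b' , arc'))
  ... | tri≈ _ b≡b' _ = b≡b'
  ... | tri> _ _ b'<b = ⊥-elim (top' (b , b'<b , arc))

proposition4p8 : (n : ℕ) (T : AltTableau n) (i j : ℕ) →
    IsCell (shape T) i j →
      (FreeCell T i j ⇔ ∃₂ (λ i' j' → OutCrossing T i' j i j'))
      × (FreeCell T i j → ∀ i₁ j₁ i₂ j₂ →
           OutCrossing T i₁ j i j₁ → OutCrossing T i₂ j i j₂ →
           i₁ ≡ i₂ × j₁ ≡ j₂)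
proposition4p8 n T i j cell@(rowi , colj , i<j) = mk⇔ toOutCrossing fromOutCrossing , unique
  where
  toOutCrossing : FreeCell T i j → ∃₂ (λ i' j' → OutCrossing T i' j i j')
  toOutCrossing free
    with topmostArcInto T (rowPos rowi) colj (freeCell-noUpFrom T free)
       | topmostArcOutOf T rowi (colBound colj) (freeCell-noLeftUpTo T free)
  ... | i' , i'<i , arcᵢ , topᵢ | j' , j<j' , arcⱼ , topⱼ =
    i' , j' , (arcᵢ , arcⱼ , i'<i , i<j , j<j') , topᵢ , topⱼ

  fromOutCrossing : ∃₂ (λ i' j' → OutCrossing T i' j i j') → FreeCell T i j
  fromOutCrossing (_ , _ , (arcᵢ , arcⱼ , i'<i , _ , j<j') , _) =
    freeCell-intro T cell
      (λ u i≤u → arcInto-blocksUp T (colBound colj) arcᵢ u (<-≤-trans i'<i i≤u))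
      (λ ℓ ℓ≤j → arcOutOf-blocksLeft T (rowPos rowi) arcⱼ ℓ (≤-<-trans ℓ≤j j<j'))

  unique : FreeCell T i j → ∀ i₁ j₁ i₂ j₂ →
           OutCrossing T i₁ j i j₁ → OutCrossing T i₂ j i j₂ → i₁ ≡ i₂ × j₁ ≡ j₂
  unique _ _ _ _ _ ((a₁ , b₁ , _) , r₁ , l₁) ((a₂ , b₂ , _) , r₂ , l₂) =
    topmostRight-unique T a₁ a₂ r₁ r₂ , topmostLeft-unique T b₁ b₂ l₁ l₂
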